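{- Let $n,k$ be positive integers with $n\ge 2k$ and $\gcd(n,k)=1$, let $A\subseteq V(Q(n,k))$ be an independent set of $Q(n,k)$ and $X\in A$. Then for each $j\in\{1,\dots,k-1\}$, $A$ contains at most one right $j$-neighbor of $X$. In particular, $|A|\le k$.
   Context: For a positive integer $n$ let $[n]=\{1,\dots,n\}$ and let $C_n$ be the cycle on $[n]$ with edges $\{i,i+1\}$ ($1\le i\le n-1$) and $\{n,1\}$. The Schrijver graph $\mathrm{SG}(n,k)$ ($n\ge 2k$) has as vertices the $k$-subsets of $[n]$ containing no two cyclically consecutive elements, two vertices adjacent iff they are disjoint. An arc of $C_n$ is a set $\{i,i+1,\dots,i+m-1\}$ (addition mod $n$) with $1\le m\le n-1$. A set $U\subseteq[n]$ is well-spread if for any two arcs $A,B$ with $|A|=|B|$ we have $\big||A\cap U|-|B\cap U|\big|\le 1$. $Q(n,k)$ is the induced subgraph of $\mathrm{SG}(n,k)$ on all well-spread $k$-subsets of $[n]$. $\rho:[n]\to[n]$ is the rotation $i\mapsto i+1$ (mod $n$), acting on subsets elementwise. When $\gcd(n,k)=1$, for distinct $X,Y\in V(Q(n,k))$ there is a unique $t\in\{1,\dots,n-1\}$ with $\rho^t(X)=Y$. For distinct $X,Y\in V(Q(n,k))$ with $X\cap Y\ne\emptyset$, $Y$ is called a right $j$-neighbor of $X$ if $|Y\cap\{i+1,i+2,\dots,i+t\}|=j$ (addition mod $n$) for some (equivalently, for every) $i\in X\cap Y$, where $\rho^t(X)=Y$. -}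

module Defs where

open import Data.Nat using (ℕ; zero; suc; _+_; _∸_; _≤_; NonZero)
open import Data.Nat.DivMod using (_%_; m%n<n)
open import Data.Bool using (Bool; true; false; _∧_)
open import Data.Fin using (Fin; toℕ; fromℕ<)
open import Data.Vec using (Vec; lookup; tabulate)
open import Data.Fin.Subset using (Subset; _∈_; ∣_∣; _∩_; Nonempty; Empty)
open import Data.List using (List; length)
open import Data.List.Relation.Unary.All using (All)
open import Data.List.Relation.Unary.Unique.Propositional using (Unique)
import Data.List.Membership.Propositional as LM
open import Data.Product using (_×_; Σ; ∃; ∃-syntax)
open import Relation.Binary.PropositionalEquality using (_≡_; _≢_)
open import Relation.Nullary using (¬_)
open import Function using (_∘_)

-- Convention: [n] is represented by Fin n = {0,…,n-1} (element i+1 of the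
-- paper ↦ i).  Cyclic arithmetic is done on ℕ and reduced mod n.

pos : (n : ℕ) → .{{_ : NonZero n}} → ℕ → Fin n
pos n a = fromℕ< (m%n<n a n)

_at_ : {n : ℕ} → .{{_ : NonZero n}} → Subset n → ℕ → Bool
_at_ {n} U a = lookup U (pos n a)

arcCount : {n : ℕ} → .{{_ : NonZero n}} → Subset n → ℕ → ℕ → ℕ
arcCount U s zero = 0
arcCount U s (suc m) with U at s
... | true  = suc (arcCount U (suc s) m)
... | false = arcCount U (suc s) m

NoConsecutive : {n : ℕ} → .{{_ : NonZero n}} → Subset n → Set
NoConsecutive {n} U = (i : Fin n) → ¬ ((U at toℕ i) ≡ true × (U at suc (toℕ i)) ≡ true)

-- well-spread: for arcs A (start s), B (start s') of the same length m,
-- 1 ≤ m ≤ n-1, | |A∩U| - |B∩U| | ≤ 1 (stated for all ordered pairs)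
WellSpread : {n : ℕ} → .{{_ : NonZero n}} → Subset n → Set
WellSpread {n} U = (s s' : Fin n) (m : ℕ) → 1 ≤ m → m ≤ n ∸ 1 →
  arcCount U (toℕ s) m ≤ suc (arcCount U (toℕ s') m)

IsQVertex : (n k : ℕ) → .{{_ : NonZero n}} → Subset n → Set
IsQVertex n k U = ∣ U ∣ ≡ k × NoConsecutive U × WellSpread U

-- rotation ρ : i ↦ i+1 (mod n) acting elementwise: (ρ U) ∋ e ⇔ U ∋ e-1
ρ : {n : ℕ} → .{{_ : NonZero n}} → Subset n → Subset n
ρ {n} U = tabulate (λ e → U at (toℕ e + (n ∸ 1)))

ρ^ : {n : ℕ} → .{{_ : NonZero n}} → ℕ → Subset n → Subset n
ρ^ zero U = U
ρ^ (suc t) U = ρ (ρ^ t U)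

Disjoint : {n : ℕ} → Subset n → Subset n → Set
Disjoint X Y = Empty (X ∩ Y)

RightNeighbour : {n : ℕ} → .{{_ : NonZero n}} → ℕ → Subset n → Subset n → Set
RightNeighbour {n} j X Y =
  X ≢ Y × Nonempty (X ∩ Y) ×
  ∃[ t ] (1 ≤ t × t ≤ n ∸ 1 × ρ^ t X ≡ Y ×
          ∃[ i ] (i ∈ X × i ∈ Y × arcCount Y (suc (toℕ i)) t ≡ j))

IndependentQ : (n k : ℕ) → .{{_ : NonZero n}} → List (Subset n) → Set
IndependentQ n k A =
  Unique A × All (IsQVertex n k) A ×
  (∀ {X Y} → X LM.∈ A → Y LM.∈ A → ¬ Disjoint X Y)

{-# OPTIONS --safe #-}

-- A well-spread k-subset U of ℤ/n is a mechanical word { s | (c − s·k) mod n < k }: by balance the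
-- potential n·|U ∩ [0, s)| − s·k varies by less than n on [0, n], and its distance to its minimum is
-- the residue of c − s·k.
-- Right j-neighbours ρ^t₁ X and ρ^t₂ X with t₁ + 2 ≤ t₂ would give two windows of length t₁ + 1
-- whose counts in X differ by 2; if t₂ = t₁ + 1 they are ρ-translates, hence disjoint because they
-- contain no two consecutive elements.
-- Members of an independent set pairwise intersect, so their intercepts pairwise differ by less than
-- k in ℤ/n; folding the offsets from the intercept of X into [0, k) is then injective, so |A| ≤ k.

module Submission where

open import Defs
open import Data.Nat using (ℕ; _+_; _∸_; _≤_; _*_; NonZero)
open import Data.Nat.GCD using (gcd)
open import Data.Fin.Subset using (Subset)
open import Data.List using (List; length)
open import Data.List.Membership.Propositional using (_∈_)
open import Data.Product using (_×_)
open import Relation.Binary.PropositionalEquality using (_≡_)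

open import Data.Bool.Base using (Bool; true; false)
open import Data.Bool.Properties using (T-≡; ⇔→≡)
open import Data.Empty using (⊥)
open import Data.Fin.Base as Fin using (Fin; toℕ; fromℕ<)
open import Data.Fin.Properties using (toℕ<n; fromℕ<-cong; fromℕ<-toℕ; toℕ-fromℕ<; injective⇒≤)
open import Data.Fin.Subset using (∣_∣; _∩_; Empty) renaming (_∈_ to _∈ˢ_)
open import Data.Fin.Subset.Properties using (x∈p∩q⁻; ∩-comm)
open import Data.List.Base as List using (upTo; _∷_)
import Data.List.Relation.Unary.All as All
open import Data.List.Relation.Unary.AllPairs using (_∷_)
open import Data.List.Relation.Unary.Unique.Propositional using (Unique)
open import Data.List.Membership.Propositional.Properties using (∈-upTo⁺; ∈-upTo⁻; ∈-lookup)
open import Data.List.Extrema.Nat using (argmin; argmin-all; f[argmin]≤f[xs])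
open import Data.Nat.Base using (zero; suc; _<_; _<ᵇ_; z≤n; s≤s; z<s; s≤s⁻¹; >-nonZero; >-nonZero⁻¹)
open import Data.Nat.DivMod using (_%_; m%n<n; m%n%n≡m%n; %-distribˡ-+; m*n%n≡0; m<n⇒m%n≡m)
open import Data.Nat.Properties
open import Algebra.Properties.CommutativeSemigroup +-commutativeSemigroup
  using (interchange; x∙yz≈y∙xz; x∙yz≈xz∙y; xy∙z≈xz∙y)
open import Data.Nat.Tactic.RingSolver using (solve-∀)
open import Data.Product using (_,_; proj₁; proj₂; ∃-syntax)
open import Data.Sum using (_⊎_; inj₁; inj₂; [_,_])
open import Data.Vec.Base using (Vec; []; _∷_; lookup; tabulate)
open import Data.Vec.Properties using (lookup∘tabulate; tabulate∘lookup; tabulate-cong; []=⇒lookup)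
open import Function.Base using (_∘_)
open import Function.Bundles using (Equivalence; mk⇔)
open import Relation.Binary.Bundles using (Setoid)
import Relation.Binary.Construct.On as On
open import Relation.Binary.PropositionalEquality hiding ([_])
import Relation.Binary.Reasoning.Setoid as SetoidReasoning
open import Relation.Nullary using (¬_; Dec; yes; no; contradiction)
open import Relation.Nullary.Decidable using (_⊎-dec_)

bit : Bool → ℕ
bit true  = 1
bit false = 0

count : (ℕ → Bool) → ℕ → ℕ → ℕ
count f s zero    = 0
count f s (suc m) = bit (f s) + count f (suc s) m

count-+ : ∀ f s a b → count f s (a + b) ≡ count f s a + count f (s + a) b
count-+ f s zero    b = cong (λ x → count f x b) (sym (+-identityʳ s))
count-+ f s (suc a) b = begin
  bit (f s) + count f (suc s) (a + b)                       ≡⟨ cong (bit (f s) +_) (count-+ f (suc s) a b) ⟩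
  bit (f s) + (count f (suc s) a + count f (suc s + a) b)   ≡⟨ +-assoc (bit (f s)) _ _ ⟨
  bit (f s) + count f (suc s) a + count f (suc s + a) b     ≡⟨ cong (λ x → count f s (suc a) + count f x b) (+-suc s a) ⟨
  bit (f s) + count f (suc s) a + count f (s + suc a) b     ∎
  where open ≡-Reasoning

count-snoc : ∀ f s m → count f s (suc m) ≡ count f s m + bit (f (s + m))
count-snoc f s m = begin
  count f s (suc m)                        ≡⟨ cong (count f s) (+-comm 1 m) ⟩
  count f s (m + 1)                        ≡⟨ count-+ f s m 1 ⟩
  count f s m + (bit (f (s + m)) + 0)      ≡⟨ cong (count f s m +_) (+-identityʳ _) ⟩
  count f s m + bit (f (s + m))            ∎
  where open ≡-Reasoning

count-shift : ∀ {f g} c → (∀ x → f x ≡ g (x + c)) → ∀ s m → count f s m ≡ count g (s + c) m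
count-shift c f≡g s zero    = refl
count-shift c f≡g s (suc m) = cong₂ _+_ (cong bit (f≡g s)) (count-shift c f≡g (suc s) m)

count-monoʳ : ∀ f s {m m′} → m ≤ m′ → count f s m ≤ count f s m′
count-monoʳ f s {m} {m′} m≤m′ = begin
  count f s m                              ≤⟨ m≤m+n _ _ ⟩
  count f s m + count f (s + m) (m′ ∸ m)   ≡⟨ count-+ f s m (m′ ∸ m) ⟨
  count f s (m + (m′ ∸ m))                 ≡⟨ cong (count f s) (m+[n∸m]≡n m≤m′) ⟩
  count f s m′                             ∎
  where open ≤-Reasoning

count≤length : ∀ f s m → count f s m ≤ m
count≤length f s zero    = z≤n
count≤length f s (suc m) = +-mono-≤ (bit≤1 (f s)) (count≤length f (suc s) m)
  where
  bit≤1 : ∀ b → bit b ≤ 1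
  bit≤1 true  = ≤-refl
  bit≤1 false = z≤n

windowSum : (ℕ → Bool) → ℕ → ℕ → ℕ → ℕ
windowSum f s m zero    = 0
windowSum f s m (suc N) = count f s m + windowSum f (suc s) m N

windowSum-emptyWindow : ∀ f s N → windowSum f s 0 N ≡ 0
windowSum-emptyWindow f s zero    = refl
windowSum-emptyWindow f s (suc N) = windowSum-emptyWindow f (suc s) N

windowSum-suc : ∀ f s m N → windowSum f s (suc m) N ≡ count f s N + windowSum f (suc s) m N
windowSum-suc f s m zero    = refl
windowSum-suc f s m (suc N) = begin
  (bit (f s) + count f (suc s) m) + windowSum f (suc s) (suc m) N
    ≡⟨ cong ((bit (f s) + count f (suc s) m) +_) (windowSum-suc f (suc s) m N) ⟩
  (bit (f s) + count f (suc s) m) + (count f (suc s) N + windowSum f (suc (suc s)) m N)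
    ≡⟨ interchange (bit (f s)) (count f (suc s) m) (count f (suc s) N) _ ⟩
  (bit (f s) + count f (suc s) N) + (count f (suc s) m + windowSum f (suc (suc s)) m N)
    ∎
  where open ≡-Reasoning

windowSum-≤ : ∀ {f m c} → (∀ x → count f x m ≤ c) → ∀ s N → windowSum f s m N ≤ N * c
windowSum-≤ count≤c s zero    = z≤n
windowSum-≤ count≤c s (suc N) = +-mono-≤ (count≤c s) (windowSum-≤ count≤c (suc s) N)

windowSum-≥ : ∀ {f m c} → (∀ x → c ≤ suc (count f x m)) → ∀ s N → N * c ≤ N + windowSum f s m N
windowSum-≥ c≤count s zero    = z≤n
windowSum-≥ {f} {m} {c} c≤count s (suc N) = begin
  c + N * c                                       ≤⟨ +-mono-≤ (c≤count s) (windowSum-≥ c≤count (suc s) N) ⟩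
  suc (count f s m) + (N + windowSum f (suc s) m N) ≡⟨ cong suc (x∙yz≈y∙xz (count f s m) N _) ⟩
  suc N + (count f s m + windowSum f (suc s) m N)   ∎
  where open ≤-Reasoning

module Modular (n : ℕ) .{{_ : NonZero n}} where

  infix 4 _≈_
  _≈_ : ℕ → ℕ → Set
  a ≈ b = a % n ≡ b % n

  ≈-setoid : Setoid _ _
  ≈-setoid = On.setoid {B = ℕ} (setoid ℕ) (_% n)

  open Setoid ≈-setoid public using () renaming (sym to ≈-sym; trans to ≈-trans)
  module ≈-Reasoning = SetoidReasoning ≈-setoid

  suc[n∸1]≡n : suc (n ∸ 1) ≡ n
  suc[n∸1]≡n = m+[n∸m]≡n (>-nonZero⁻¹ n)

  ≡⇒≈ : ∀ {a b} → a ≡ b → a ≈ b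
  ≡⇒≈ = cong (_% n)

  %≈ : ∀ a → a % n ≈ a
  %≈ a = m%n%n≡m%n a n

  +-cong : ∀ {a b c d} → a ≈ b → c ≈ d → a + c ≈ b + d
  +-cong {a} {b} {c} {d} a≈b c≈d = begin
    (a + c) % n              ≡⟨ %-distribˡ-+ a c n ⟩
    (a % n + c % n) % n      ≡⟨ cong₂ (λ x y → (x + y) % n) a≈b c≈d ⟩
    (b % n + d % n) % n      ≡⟨ %-distribˡ-+ b d n ⟨
    (b + d) % n              ∎
    where open ≡-Reasoning

  +-congˡ : ∀ a {c d} → c ≈ d → a + c ≈ a + d
  +-congˡ a = +-cong {a} {a} refl

  +-congʳ : ∀ {a b} c → a ≈ b → a + c ≈ b + c
  +-congʳ c a≈b = +-cong a≈b refl

  *n≈0 : ∀ m → m * n ≈ 0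
  *n≈0 m = trans (m*n%n≡0 m n) (sym (m*n%n≡0 0 n))

  n≈0 : n ≈ 0
  n≈0 = trans (cong (_% n) (sym (*-identityˡ n))) (*n≈0 1)

  +-absorbs-0 : ∀ a {z} → z ≈ 0 → a + z ≈ a
  +-absorbs-0 a z≈0 = trans (+-congˡ a z≈0) (≡⇒≈ (+-identityʳ a))

  +-cancelʳ : ∀ {a b} c → a + c ≈ b + c → a ≈ b
  +-cancelʳ {a} {b} c a+c≈b+c = begin
    a                          ≈⟨ +-absorbs-0 a c+c⁻≈0 ⟨
    a + (c + c⁻)               ≡⟨ +-assoc a c c⁻ ⟨
    a + c + c⁻                 ≈⟨ +-congʳ c⁻ a+c≈b+c ⟩
    b + c + c⁻                 ≡⟨ +-assoc b c c⁻ ⟩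
    b + (c + c⁻)               ≈⟨ +-absorbs-0 b c+c⁻≈0 ⟩
    b                          ∎
    where
    open ≈-Reasoning
    c⁻ = n ∸ c % n
    c+c⁻≈0 : c + c⁻ ≈ 0
    c+c⁻≈0 = ≈-trans (+-congʳ c⁻ (≈-sym (%≈ c))) (≈-trans (≡⇒≈ (m+[n∸m]≡n (<⇒≤ (m%n<n c n)))) n≈0)

  suc+[n∸1]≈ : ∀ a → suc a + (n ∸ 1) ≈ a
  suc+[n∸1]≈ a = ≈-trans (≡⇒≈ (trans (sym (+-suc a (n ∸ 1))) (cong (a +_) suc[n∸1]≡n))) (+-absorbs-0 a n≈0)

  ≈⇒≡ : ∀ {a b} → a < n → b < n → a ≈ b → a ≡ b
  ≈⇒≡ a<n b<n a≈b = trans (sym (m<n⇒m%n≡m a<n)) (trans a≈b (m<n⇒m%n≡m b<n))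

  +-cancelˡ : ∀ c {a b} → c + a ≈ c + b → a ≈ b
  +-cancelˡ c {a} {b} c+a≈c+b = +-cancelʳ c (≈-trans (≡⇒≈ (+-comm a c)) (≈-trans c+a≈c+b (≡⇒≈ (+-comm c b))))

  offset : ℕ → ℕ → ℕ
  offset c₁ c₂ = (c₂ + (n ∸ c₁)) % n

  offset<n : ∀ c₁ c₂ → offset c₁ c₂ < n
  offset<n c₁ c₂ = m%n<n _ n

  +-offset : ∀ {c₁} c₂ → c₁ ≤ n → c₁ + offset c₁ c₂ ≈ c₂
  +-offset {c₁} c₂ c₁≤n = begin
    c₁ + offset c₁ c₂          ≈⟨ +-congˡ c₁ (%≈ _) ⟩
    c₁ + (c₂ + (n ∸ c₁))       ≡⟨ x∙yz≈y∙xz c₁ c₂ (n ∸ c₁) ⟩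
    c₂ + (c₁ + (n ∸ c₁))       ≡⟨ cong (c₂ +_) (m+[n∸m]≡n c₁≤n) ⟩
    c₂ + n                     ≈⟨ +-absorbs-0 c₂ n≈0 ⟩
    c₂                         ∎
    where open ≈-Reasoning

  offset-injective : ∀ {c c₁ c₂} → c ≤ n → c₁ < n → c₂ < n → offset c c₁ ≡ offset c c₂ → c₁ ≡ c₂
  offset-injective {c} {c₁} {c₂} c≤n c₁<n c₂<n eq = ≈⇒≡ c₁<n c₂<n (begin
    c₁                  ≈⟨ +-offset c₁ c≤n ⟨
    c + offset c c₁     ≡⟨ cong (c +_) eq ⟩
    c + offset c c₂     ≈⟨ +-offset c₂ c≤n ⟩
    c₂                  ∎)
    where open ≈-Reasoning

  offset-trans : ∀ {c₀ c₁} c₂ → c₀ ≤ n → c₁ ≤ n → offset c₀ c₁ + offset c₁ c₂ ≈ offset c₀ c₂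
  offset-trans {c₀} {c₁} c₂ c₀≤n c₁≤n = +-cancelˡ c₀ (begin
    c₀ + (offset c₀ c₁ + offset c₁ c₂)    ≡⟨ +-assoc c₀ _ _ ⟨
    c₀ + offset c₀ c₁ + offset c₁ c₂      ≈⟨ +-congʳ (offset c₁ c₂) (+-offset c₁ c₀≤n) ⟩
    c₁ + offset c₁ c₂                     ≈⟨ +-offset c₂ c₁≤n ⟩
    c₂                                    ≈⟨ +-offset c₂ c₀≤n ⟨
    c₀ + offset c₀ c₂                     ∎)
    where open ≈-Reasoning

  residues-close : ∀ {k x y d} → k ≤ n → x < k → y < k → d < n → x + d ≈ y → d < k ⊎ n ∸ k < d
  residues-close {k} {x} {y} {d} k≤n x<k y<k d<n x+d≈y with x ≤? y
  ... | yes x≤y = inj₁ (subst (_< k) (sym d≡y∸x) (≤-trans (s≤s (m∸n≤m y x)) y<k))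
    where
    d≡y∸x : d ≡ y ∸ x
    d≡y∸x = ≈⇒≡ d<n (≤-trans (s≤s (m∸n≤m y x)) (≤-trans y<k k≤n))
              (+-cancelˡ x (≈-trans x+d≈y (≡⇒≈ (sym (m+[n∸m]≡n x≤y)))))
  ... | no  x≰y = inj₂ (subst (n ∸ k <_) (sym d≡y+[n∸x]) (≤-trans (∸-monoʳ-< x<k k≤n) (m≤n+m (n ∸ x) y)))
    where
    x≤n = ≤-trans (<⇒≤ x<k) k≤n
    y+[n∸x]<n : y + (n ∸ x) < n
    y+[n∸x]<n = subst₂ _<_ (+-comm (n ∸ x) y) (m∸n+n≡m x≤n) (+-monoʳ-< (n ∸ x) (≰⇒> x≰y))
    d≡y+[n∸x] : d ≡ y + (n ∸ x)
    d≡y+[n∸x] = ≈⇒≡ d<n y+[n∸x]<n (+-cancelˡ x (≈-trans x+d≈y (≈-sym (begin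
      x + (y + (n ∸ x))    ≡⟨ x∙yz≈y∙xz x y (n ∸ x) ⟩
      y + (x + (n ∸ x))    ≡⟨ cong (y +_) (m+[n∸m]≡n x≤n) ⟩
      y + n                ≈⟨ +-absorbs-0 y n≈0 ⟩
      y                    ∎))))
      where open ≈-Reasoning

  count-periodic : ∀ {f} → (∀ {a b} → a ≈ b → f a ≡ f b) →
                   ∀ {a b} → a ≈ b → ∀ m → count f a m ≡ count f b m
  count-periodic f-per a≈b zero    = refl
  count-periodic f-per a≈b (suc m) = cong₂ _+_ (cong bit (f-per a≈b)) (count-periodic f-per (+-congˡ 1 a≈b) m)

Balanced : (n : ℕ) → (ℕ → Bool) → Set
Balanced n f = ∀ s s′ m → 1 ≤ m → m ≤ n ∸ 1 → count f s m ≤ suc (count f s′ m)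

-- What RightNeighbour j X (ρᵗ X) says about f = X at_, where p + t is the common element.
Return : (ℕ → Bool) → ℕ → ℕ → Set
Return f t j = ∃[ p ] (f p ≡ true × f (p + t) ≡ true × count f (suc p) t ≡ j)

no-long-return-gap : ∀ {n f t₁ t₂ j} → Balanced n f → Return f t₁ j → Return f t₂ j →
  t₂ ≤ n ∸ 1 → suc (suc t₁) ≤ t₂ → ⊥
no-long-return-gap {n} {f} {t₁} {suc t₂′} {j} balanced (p , fp , _ , count₁) (q , _ , fq+t₂ , count₂)
  t₂≤n∸1 2+t₁≤t₂@(s≤s 1+t₁≤t₂′) = 1+n≰n (begin
    suc j                            ≡⟨ cong₂ _+_ (cong bit fp) count₁ ⟨
    count f p (suc t₁)               ≤⟨ balanced p (suc q) (suc t₁) (s≤s z≤n) 1+t₁≤n∸1 ⟩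
    suc (count f (suc q) (suc t₁))   ≤⟨ s≤s (count-monoʳ f (suc q) 1+t₁≤t₂′) ⟩
    suc (count f (suc q) t₂′)        ≡⟨ +-comm 1 _ ⟩
    count f (suc q) t₂′ + 1          ≡⟨ cong (λ b → count f (suc q) t₂′ + bit b) f[q+t₂] ⟨
    count f (suc q) t₂′ + bit (f (suc q + t₂′))  ≡⟨ count-snoc f (suc q) t₂′ ⟨
    count f (suc q) (suc t₂′)        ≡⟨ count₂ ⟩
    j                                ∎)
  where
  open ≤-Reasoning
  1+t₁≤n∸1 = ≤-trans (<⇒≤ 2+t₁≤t₂) t₂≤n∸1
  f[q+t₂] : f (suc q + t₂′) ≡ true
  f[q+t₂] = trans (cong f (sym (+-suc q t₂′))) fq+t₂

<⇒<ᵇ≡true : ∀ {m n} → m < n → (m <ᵇ n) ≡ true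
<⇒<ᵇ≡true m<n = Equivalence.to T-≡ (<⇒<ᵇ m<n)

<ᵇ≡true⇒< : ∀ {m n} → (m <ᵇ n) ≡ true → m < n
<ᵇ≡true⇒< {m} {n} eq = <ᵇ⇒< m n (Equivalence.from T-≡ eq)

opaque
  minimiser : ∀ (g : ℕ → ℕ) n → ∃[ s₀ ] (s₀ ≤ n × ∀ {s} → s ≤ n → g s₀ ≤ g s)
  minimiser g n =
    argmin g 0 (upTo (suc n)) ,
    argmin-all g {P = _≤ n} z≤n (All.tabulate (s≤s⁻¹ ∘ ∈-upTo⁻)) ,
    λ s≤n → All.lookup (f[argmin]≤f[xs] {f = g} 0 (upTo (suc n))) (∈-upTo⁺ (s≤s s≤n))

-- { s | (c − s·k) mod n < k }, with −k represented by n ∸ k.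
mechanicalWord : (n k c : ℕ) .{{_ : NonZero n}} → ℕ → Bool
mechanicalWord n k c s = (c + s * (n ∸ k)) % n <ᵇ k

module Mechanical (n k : ℕ) .{{_ : NonZero n}} {f : ℕ → Bool}
  (f-periodic : ∀ {a b} → Modular._≈_ n a b → f a ≡ f b)
  (count≡k : count f 0 n ≡ k)
  (balanced : Balanced n f)
  where

  open Modular n

  count-period : ∀ s → count f s n ≡ k
  count-period s = begin
    count f s n                        ≡⟨ count-periodic f-periodic (≈-sym (%≈ s)) n ⟩
    count f r n                        ≡⟨ cong (count f r) (m∸n+n≡m r≤n) ⟨
    count f r ((n ∸ r) + r)            ≡⟨ count-+ f r (n ∸ r) r ⟩
    count f r (n ∸ r) + count f (r + (n ∸ r)) r
      ≡⟨ cong (count f r (n ∸ r) +_) (count-periodic f-periodic (≈-trans (≡⇒≈ (m+[n∸m]≡n r≤n)) n≈0) r) ⟩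
    count f r (n ∸ r) + count f 0 r    ≡⟨ +-comm (count f r (n ∸ r)) _ ⟩
    count f 0 r + count f r (n ∸ r)    ≡⟨ count-+ f 0 r (n ∸ r) ⟨
    count f 0 (r + (n ∸ r))            ≡⟨ cong (count f 0) (m+[n∸m]≡n r≤n) ⟩
    count f 0 n                        ≡⟨ count≡k ⟩
    k                                  ∎
    where
    open ≡-Reasoning
    r = s % n
    r≤n = <⇒≤ (m%n<n s n)

  k≤n : k ≤ n
  k≤n = subst (_≤ n) count≡k (count≤length f 0 n)

  windowSum-period : ∀ s m → windowSum f s m n ≡ m * k
  windowSum-period s zero    = windowSum-emptyWindow f s n
  windowSum-period s (suc m) =
    trans (windowSum-suc f s m n) (cong₂ _+_ (count-period s) (windowSum-period (suc s) m))

  windowSum-split : ∀ s m → count f s m + windowSum f (suc s) m (n ∸ 1) ≡ m * k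
  windowSum-split s m = trans (cong (windowSum f s m) suc[n∸1]≡n) (windowSum-period s m)

  count-lower : ∀ s m → m ≤ n → m * k ≤ n * count f s m + (n ∸ 1)
  count-lower s zero    _   = z≤n
  count-lower s (suc m) m≤n with suc m ≟ n
  ... | yes refl = ≤-trans (≤-reflexive (cong (suc m *_) (sym (count-period s)))) (m≤m+n _ _)
  ... | no  m≢n  = begin
    suc m * k                                ≡⟨ windowSum-split s (suc m) ⟨
    C + windowSum f (suc s) (suc m) (n ∸ 1)  ≤⟨ +-monoʳ-≤ C (windowSum-≤ others≤ (suc s) (n ∸ 1)) ⟩
    C + (n ∸ 1) * suc C                      ≡⟨ rearrange C (n ∸ 1) ⟩
    suc (n ∸ 1) * C + (n ∸ 1)                ≡⟨ cong (λ x → x * C + (n ∸ 1)) suc[n∸1]≡n ⟩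
    n * C + (n ∸ 1)                          ∎
    where
    open ≤-Reasoning
    C = count f s (suc m)
    m<n = ∸-monoˡ-≤ 1 (≤∧≢⇒< m≤n m≢n)
    others≤ : ∀ x → count f x (suc m) ≤ suc C
    others≤ x = balanced x s (suc m) z<s m<n
    rearrange : ∀ c a → c + a * suc c ≡ suc a * c + a
    rearrange = solve-∀

  count-upper : ∀ s m → m ≤ n → n * count f s m ≤ m * k + (n ∸ 1)
  count-upper s zero    _   = ≤-trans (≤-reflexive (*-zeroʳ n)) z≤n
  count-upper s (suc m) m≤n with suc m ≟ n
  ... | yes refl = ≤-trans (≤-reflexive (cong (suc m *_) (count-period s))) (m≤m+n _ _)
  ... | no  m≢n  = begin
    n * C                                          ≡⟨ cong (_* C) suc[n∸1]≡n ⟨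
    C + (n ∸ 1) * C                                ≤⟨ +-monoʳ-≤ C (windowSum-≥ others≥ (suc s) (n ∸ 1)) ⟩
    C + ((n ∸ 1) + windowSum f (suc s) (suc m) (n ∸ 1)) ≡⟨ x∙yz≈xz∙y C (n ∸ 1) _ ⟩
    (C + windowSum f (suc s) (suc m) (n ∸ 1)) + (n ∸ 1) ≡⟨ cong (_+ (n ∸ 1)) (windowSum-split s (suc m)) ⟩
    suc m * k + (n ∸ 1)                            ∎
    where
    open ≤-Reasoning
    C = count f s (suc m)
    m<n = ∸-monoˡ-≤ 1 (≤∧≢⇒< m≤n m≢n)
    others≥ : ∀ x → C ≤ suc (count f x (suc m))
    others≥ x = balanced s x (suc m) z<s m<n

  -- The potential n·count f 0 s − s·k, shifted by n·k to stay in ℕ.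
  W : ℕ → ℕ
  W s = n * count f 0 s + k * (n ∸ s)

  W-+ : ∀ s m → s + m ≤ n → W (s + m) + m * k ≡ W s + n * count f s m
  W-+ s m s+m≤n = begin
    n * count f 0 (s + m) + k * e + m * k   ≡⟨ cong (λ x → n * x + k * e + m * k) (count-+ f 0 s m) ⟩
    n * (F + C) + k * e + m * k             ≡⟨ rearrange n F C k e m ⟩
    n * F + k * (e + m) + n * C             ≡⟨ cong (λ x → n * F + k * x + n * C) n∸s≡e+m ⟨
    n * F + k * (n ∸ s) + n * C             ∎
    where
    open ≡-Reasoning
    F = count f 0 s
    C = count f s m
    e = n ∸ (s + m)
    n∸s≡e+m : n ∸ s ≡ e + m
    n∸s≡e+m = trans (sym (m∸n+n≡m (subst (_≤ n ∸ s) (m+n∸m≡n s m) (∸-monoˡ-≤ s s+m≤n))))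
                    (cong (_+ m) (∸-+-assoc n s m))
    rearrange : ∀ n F C k e m → n * (F + C) + k * e + m * k ≡ n * F + k * (e + m) + n * C
    rearrange = solve-∀

  W-suc : ∀ s → s < n → W (suc s) + k ≡ W s + n * bit (f s)
  W-suc s s<n = begin
    W (suc s) + k              ≡⟨ cong₂ (λ x y → W x + y) (+-comm 1 s) (sym (*-identityˡ k)) ⟩
    W (s + 1) + 1 * k          ≡⟨ W-+ s 1 (subst (_≤ n) (+-comm 1 s) s<n) ⟩
    W s + n * count f s 1      ≡⟨ cong (λ x → W s + n * x) (+-identityʳ (bit (f s))) ⟩
    W s + n * bit (f s)        ∎
    where open ≡-Reasoning

  W-later≤ : ∀ s m → s + m ≤ n → W (s + m) ≤ W s + (n ∸ 1)
  W-later≤ s m s+m≤n = +-cancelʳ-≤ (m * k) _ _ (begin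
    W (s + m) + m * k             ≡⟨ W-+ s m s+m≤n ⟩
    W s + n * count f s m         ≤⟨ +-monoʳ-≤ (W s) (count-upper s m (≤-trans (m≤n+m m s) s+m≤n)) ⟩
    W s + (m * k + (n ∸ 1))       ≡⟨ x∙yz≈xz∙y (W s) (m * k) (n ∸ 1) ⟩
    W s + (n ∸ 1) + m * k         ∎)
    where open ≤-Reasoning

  W-earlier≤ : ∀ s m → s + m ≤ n → W s ≤ W (s + m) + (n ∸ 1)
  W-earlier≤ s m s+m≤n = +-cancelʳ-≤ (m * k) _ _ (begin
    W s + m * k                          ≤⟨ +-monoʳ-≤ (W s) (count-lower s m (≤-trans (m≤n+m m s) s+m≤n)) ⟩
    W s + (n * count f s m + (n ∸ 1))    ≡⟨ +-assoc (W s) _ _ ⟨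
    W s + n * count f s m + (n ∸ 1)      ≡⟨ cong (_+ (n ∸ 1)) (W-+ s m s+m≤n) ⟨
    W (s + m) + m * k + (n ∸ 1)          ≡⟨ xy∙z≈xz∙y (W (s + m)) (m * k) (n ∸ 1) ⟩
    W (s + m) + (n ∸ 1) + m * k          ∎)
    where open ≤-Reasoning

  W-close : ∀ {s t} → s ≤ n → t ≤ n → W s ≤ W t + (n ∸ 1)
  W-close {s} {t} s≤n t≤n with ≤-total t s
  ... | inj₁ t≤s = subst (λ x → W x ≤ W t + (n ∸ 1)) (m+[n∸m]≡n t≤s)
                     (W-later≤ t (s ∸ t) (subst (_≤ n) (sym (m+[n∸m]≡n t≤s)) s≤n))
  ... | inj₂ s≤t = subst (λ x → W s ≤ W x + (n ∸ 1)) (m+[n∸m]≡n s≤t)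
                     (W-earlier≤ s (t ∸ s) (subst (_≤ n) (sym (m+[n∸m]≡n s≤t)) t≤n))

  s₀ : ℕ
  s₀ = proj₁ (minimiser W n)

  s₀≤n : s₀ ≤ n
  s₀≤n = proj₁ (proj₂ (minimiser W n))

  W-min : ∀ {s} → s ≤ n → W s₀ ≤ W s
  W-min = proj₂ (proj₂ (minimiser W n))

  rank : ℕ → ℕ
  rank s = W s ∸ W s₀

  rank+W[s₀] : ∀ {s} → s ≤ n → rank s + W s₀ ≡ W s
  rank+W[s₀] s≤n = m∸n+n≡m (W-min s≤n)

  rank<n : ∀ {s} → s ≤ n → rank s < n
  rank<n {s} s≤n = begin-strict
    W s ∸ W s₀                ≤⟨ ∸-monoˡ-≤ (W s₀) (W-close s≤n s₀≤n) ⟩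
    W s₀ + (n ∸ 1) ∸ W s₀     ≡⟨ m+n∸m≡n (W s₀) (n ∸ 1) ⟩
    n ∸ 1                     <⟨ n<1+n (n ∸ 1) ⟩
    suc (n ∸ 1)               ≡⟨ suc[n∸1]≡n ⟩
    n                         ∎
    where open ≤-Reasoning

  rank-suc : ∀ {s} → s < n → rank (suc s) + k ≡ rank s + n * bit (f s)
  rank-suc {s} s<n = +-cancelʳ-≡ (W s₀) _ _ (begin
    rank (suc s) + k + W s₀          ≡⟨ xy∙z≈xz∙y (rank (suc s)) k (W s₀) ⟩
    rank (suc s) + W s₀ + k          ≡⟨ cong (_+ k) (rank+W[s₀] s<n) ⟩
    W (suc s) + k                    ≡⟨ W-suc s s<n ⟩
    W s + n * bit (f s)              ≡⟨ cong (_+ n * bit (f s)) (rank+W[s₀] (<⇒≤ s<n)) ⟨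
    rank s + W s₀ + n * bit (f s)    ≡⟨ xy∙z≈xz∙y (rank s) (W s₀) (n * bit (f s)) ⟩
    rank s + n * bit (f s) + W s₀    ∎)
    where open ≡-Reasoning

  f≡true⇒rank<k : ∀ {s} → s < n → f s ≡ true → rank s < k
  f≡true⇒rank<k {s} s<n fs = +-cancelʳ-< n (rank s) k (begin-strict
    rank s + n                  ≡⟨ cong (rank s +_) (*-identityʳ n) ⟨
    rank s + n * 1              ≡⟨ cong (λ b → rank s + n * bit b) fs ⟨
    rank s + n * bit (f s)      ≡⟨ rank-suc s<n ⟨
    rank (suc s) + k            <⟨ +-monoˡ-< k (rank<n s<n) ⟩
    n + k                       ≡⟨ +-comm n k ⟩
    k + n                       ∎)
    where open ≤-Reasoning

  f≡false⇒k≤rank : ∀ {s} → s < n → f s ≡ false → k ≤ rank s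
  f≡false⇒k≤rank {s} s<n fs = begin
    k                           ≤⟨ m≤n+m k (rank (suc s)) ⟩
    rank (suc s) + k            ≡⟨ rank-suc s<n ⟩
    rank s + n * bit (f s)      ≡⟨ cong (λ b → rank s + n * bit b) fs ⟩
    rank s + n * 0              ≡⟨ trans (cong (rank s +_) (*-zeroʳ n)) (+-identityʳ (rank s)) ⟩
    rank s                      ∎
    where open ≤-Reasoning

  f≡rank<ᵇk : ∀ {s} → s < n → f s ≡ (rank s <ᵇ k)
  f≡rank<ᵇk {s} s<n = ⇔→≡ (mk⇔ (<⇒<ᵇ≡true ∘ f≡true⇒rank<k s<n) (rank<k⇒f≡true ∘ <ᵇ≡true⇒<))
    where
    rank<k⇒f≡true : rank s < k → f s ≡ true
    rank<k⇒f≡true rank<k with f s in fs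
    ... | true  = refl
    ... | false = contradiction rank<k (≤⇒≯ (f≡false⇒k≤rank s<n fs))

  rank+sk+W[s₀]≈0 : ∀ {s} → s ≤ n → rank s + s * k + W s₀ ≈ 0
  rank+sk+W[s₀]≈0 {s} s≤n = ≈-trans (≡⇒≈ (begin
    rank s + s * k + W s₀                          ≡⟨ xy∙z≈xz∙y (rank s) (s * k) (W s₀) ⟩
    rank s + W s₀ + s * k                          ≡⟨ cong (_+ s * k) (rank+W[s₀] s≤n) ⟩
    n * count f 0 s + k * (n ∸ s) + s * k          ≡⟨ collect n (count f 0 s) k (n ∸ s) s ⟩
    n * count f 0 s + k * ((n ∸ s) + s)            ≡⟨ cong (λ x → n * count f 0 s + k * x) (m∸n+n≡m s≤n) ⟩
    n * count f 0 s + k * n                        ≡⟨ factor n (count f 0 s) k ⟩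
    (count f 0 s + k) * n                          ∎)) (*n≈0 (count f 0 s + k))
    where
    open ≡-Reasoning
    collect : ∀ n F k e s → n * F + k * e + s * k ≡ n * F + k * (e + s)
    collect = solve-∀
    factor : ∀ n F k → n * F + k * n ≡ (F + k) * n
    factor = solve-∀

  rank≈ : ∀ {s} → s < n → rank s ≈ rank 0 + s * (n ∸ k)
  rank≈ {s} s<n = begin
    rank s                             ≈⟨ +-absorbs-0 (rank s) (*n≈0 s) ⟨
    rank s + s * n                     ≡⟨ cong (λ x → rank s + s * x) (m+[n∸m]≡n k≤n) ⟨
    rank s + s * (k + (n ∸ k))         ≡⟨ distrib (rank s) s k (n ∸ k) ⟩
    rank s + s * k + s * (n ∸ k)       ≈⟨ +-congʳ (s * (n ∸ k)) rank≈rank[0] ⟩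
    rank 0 + s * (n ∸ k)               ∎
    where
    open ≈-Reasoning
    distrib : ∀ r s a b → r + s * (a + b) ≡ r + s * a + s * b
    distrib = solve-∀
    rank≈rank[0] : rank s + s * k ≈ rank 0
    rank≈rank[0] = +-cancelʳ (W s₀) (≈-trans (rank+sk+W[s₀]≈0 (<⇒≤ s<n))
                     (≈-sym (≈-trans (≡⇒≈ (cong (_+ W s₀) (sym (+-identityʳ (rank 0))))) (rank+sk+W[s₀]≈0 z≤n))))

  balanced⇒mechanical : ∃[ c ] (c < n × ∀ s → s < n → f s ≡ mechanicalWord n k c s)
  balanced⇒mechanical = rank 0 , rank<n z≤n , λ s s<n →
    trans (f≡rank<ᵇk s<n) (cong (_<ᵇ k) (trans (sym (m<n⇒m%n≡m (rank<n (<⇒≤ s<n)))) (rank≈ s<n)))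

∣∷∣ : ∀ {N} b (V : Vec Bool N) → ∣ b ∷ V ∣ ≡ bit b + ∣ V ∣
∣∷∣ true  V = refl
∣∷∣ false V = refl

count≡∣∣ : ∀ {N} (V : Vec Bool N) f s → (∀ i → f (toℕ i + s) ≡ lookup V i) → count f s N ≡ ∣ V ∣
count≡∣∣ []      f s f≡V = refl
count≡∣∣ {suc N} (b ∷ V) f s f≡V = begin
  bit (f s) + count f (suc s) N    ≡⟨ cong₂ _+_ (cong bit (f≡V Fin.zero)) (count≡∣∣ V f (suc s) f≡tail) ⟩
  bit b + ∣ V ∣                    ≡⟨ ∣∷∣ b V ⟨
  ∣ b ∷ V ∣                        ∎
  where
  open ≡-Reasoning
  f≡tail : ∀ i → f (toℕ i + suc s) ≡ lookup V i
  f≡tail i = trans (cong f (+-suc (toℕ i) s)) (f≡V (Fin.suc i))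

module SubsetSequence (n : ℕ) .{{_ : NonZero n}} where
  open Modular n

  at-periodic : ∀ (U : Subset n) {a b} → a ≈ b → U at a ≡ U at b
  at-periodic U a≈b = cong (lookup U) (fromℕ<-cong _ _ a≈b (m%n<n _ n) (m%n<n _ n))

  toℕ-pos : ∀ a → toℕ (pos n a) ≡ a % n
  toℕ-pos a = toℕ-fromℕ< (m%n<n a n)

  lookup≡at : ∀ (U : Subset n) i → lookup U i ≡ U at toℕ i
  lookup≡at U i = cong (lookup U) (sym (begin
    fromℕ< (m%n<n (toℕ i) n)   ≡⟨ fromℕ<-cong _ _ (m<n⇒m%n≡m (toℕ<n i)) (m%n<n (toℕ i) n) (toℕ<n i) ⟩
    fromℕ< (toℕ<n i)           ≡⟨ fromℕ<-toℕ i (toℕ<n i) ⟩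
    i                          ∎))
    where open ≡-Reasoning

  ∈⇒at : ∀ {U : Subset n} {i} → i ∈ˢ U → U at toℕ i ≡ true
  ∈⇒at {U} {i} i∈U = trans (sym (lookup≡at U i)) ([]=⇒lookup i∈U)

  ≗⇒≡ : ∀ {U V : Subset n} → (∀ a → a < n → U at a ≡ V at a) → U ≡ V
  ≗⇒≡ {U} {V} U≗V = begin
    U                      ≡⟨ tabulate∘lookup U ⟨
    tabulate (lookup U)    ≡⟨ tabulate-cong lookup-U≗V ⟩
    tabulate (lookup V)    ≡⟨ tabulate∘lookup V ⟩
    V                      ∎
    where
    open ≡-Reasoning
    lookup-U≗V : ∀ i → lookup U i ≡ lookup V i
    lookup-U≗V i = trans (lookup≡at U i) (trans (U≗V _ (toℕ<n i)) (sym (lookup≡at V i)))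

  arcCount≡count : ∀ (U : Subset n) s m → arcCount U s m ≡ count (U at_) s m
  arcCount≡count U s zero = refl
  arcCount≡count U s (suc m) with U at s
  ... | true  = cong suc (arcCount≡count U (suc s) m)
  ... | false = arcCount≡count U (suc s) m

  ∣∣≡count : ∀ (U : Subset n) → ∣ U ∣ ≡ count (U at_) 0 n
  ∣∣≡count U = sym (count≡∣∣ U (U at_) 0 λ i → trans (cong (U at_) (+-identityʳ (toℕ i))) (sym (lookup≡at U i)))

  ρ-at-suc : ∀ (U : Subset n) a → ρ U at suc a ≡ U at a
  ρ-at-suc U a = begin
    ρ U at suc a                        ≡⟨ lookup∘tabulate _ (pos n (suc a)) ⟩
    U at (toℕ (pos n (suc a)) + (n ∸ 1)) ≡⟨ at-periodic U shift ⟩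
    U at a                              ∎
    where
    open ≡-Reasoning
    shift : toℕ (pos n (suc a)) + (n ∸ 1) ≈ a
    shift = ≈-trans (+-congʳ (n ∸ 1) (≈-trans (≡⇒≈ (toℕ-pos (suc a))) (%≈ (suc a)))) (suc+[n∸1]≈ a)

  ρ^-at : ∀ t (U : Subset n) a → ρ^ t U at (a + t) ≡ U at a
  ρ^-at zero    U a = cong (U at_) (+-identityʳ a)
  ρ^-at (suc t) U a = begin
    ρ (ρ^ t U) at (a + suc t)   ≡⟨ cong (ρ (ρ^ t U) at_) (+-suc a t) ⟩
    ρ (ρ^ t U) at suc (a + t)   ≡⟨ ρ-at-suc (ρ^ t U) (a + t) ⟩
    ρ^ t U at (a + t)           ≡⟨ ρ^-at t U a ⟩
    U at a                      ∎
    where open ≡-Reasoning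

  wellSpread⇒balanced : ∀ {U : Subset n} → WellSpread U → Balanced n (U at_)
  wellSpread⇒balanced {U} ws s s′ m 1≤m m≤n∸1 =
    subst₂ (λ x y → x ≤ suc y) (arcCount≡countₛ s) (arcCount≡countₛ s′)
      (ws (pos n s) (pos n s′) m 1≤m m≤n∸1)
    where
    arcCount≡countₛ : ∀ x → arcCount U (toℕ (pos n x)) m ≡ count (U at_) x m
    arcCount≡countₛ x = begin
      arcCount U (toℕ (pos n x)) m     ≡⟨ arcCount≡count U _ m ⟩
      count (U at_) (toℕ (pos n x)) m  ≡⟨ cong (λ y → count (U at_) y m) (toℕ-pos x) ⟩
      count (U at_) (x % n) m          ≡⟨ count-periodic (at-periodic U) (%≈ x) m ⟩
      count (U at_) x m                ∎
      where open ≡-Reasoning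

  noConsecutive⇒disjoint-ρ : ∀ {U : Subset n} → NoConsecutive U → Disjoint U (ρ U)
  noConsecutive⇒disjoint-ρ {U} noCons (e , e∈U∩ρU) = noCons i (U[i] , U[i+1])
    where
    e∈U = proj₁ (x∈p∩q⁻ U (ρ U) e∈U∩ρU)
    e∈ρU = proj₂ (x∈p∩q⁻ U (ρ U) e∈U∩ρU)
    i = pos n (toℕ e + (n ∸ 1))
    suc-i≈e : suc (toℕ i) ≈ toℕ e
    suc-i≈e = ≈-trans (+-congˡ 1 (≈-trans (≡⇒≈ (toℕ-pos _)) (%≈ _))) (suc+[n∸1]≈ (toℕ e))
    U[i+1] : U at suc (toℕ i) ≡ true
    U[i+1] = trans (at-periodic U suc-i≈e) (∈⇒at e∈U)
    U[i] : U at toℕ i ≡ true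
    U[i] = trans (sym (ρ-at-suc U (toℕ i))) (trans (at-periodic (ρ U) suc-i≈e) (∈⇒at e∈ρU))

module RightNeighbours (n : ℕ) .{{_ : NonZero n}} where
  open Modular n
  open SubsetSequence n

  rightNeighbour⇒return : ∀ {j} {X Y : Subset n} → RightNeighbour j X Y →
    ∃[ t ] (t ≤ n ∸ 1 × ρ^ t X ≡ Y × Return (X at_) t j)
  rightNeighbour⇒return {j} {X} {Y} (_ , _ , t , _ , t≤n∸1 , ρᵗX≡Y , i , i∈X , i∈Y , arc≡j) =
    t , t≤n∸1 , ρᵗX≡Y , p , X[p] , X[p+t] , count≡j
    where
    p = toℕ i + t * (n ∸ 1)
    p+t≈i : p + t ≈ toℕ i
    p+t≈i = ≈-trans (≡⇒≈ (begin
      toℕ i + t * (n ∸ 1) + t        ≡⟨ +-assoc (toℕ i) _ t ⟩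
      toℕ i + (t * (n ∸ 1) + t)      ≡⟨ cong (toℕ i +_) (+-comm _ t) ⟩
      toℕ i + (t + t * (n ∸ 1))      ≡⟨ cong (toℕ i +_) (*-suc t (n ∸ 1)) ⟨
      toℕ i + t * suc (n ∸ 1)        ≡⟨ cong (λ x → toℕ i + t * x) suc[n∸1]≡n ⟩
      toℕ i + t * n                  ∎)) (+-absorbs-0 (toℕ i) (*n≈0 t))
      where open ≡-Reasoning
    Y-shift : ∀ a → X at a ≡ Y at (a + t)
    Y-shift a = trans (sym (ρ^-at t X a)) (cong (_at (a + t)) ρᵗX≡Y)
    X[p] : X at p ≡ true
    X[p] = trans (Y-shift p) (trans (at-periodic Y p+t≈i) (∈⇒at i∈Y))
    X[p+t] : X at (p + t) ≡ true
    X[p+t] = trans (at-periodic X p+t≈i) (∈⇒at i∈X)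
    count≡j : count (X at_) (suc p) t ≡ j
    count≡j = begin
      count (X at_) (suc p) t          ≡⟨ count-shift t Y-shift (suc p) t ⟩
      count (Y at_) (suc p + t) t      ≡⟨ count-periodic (at-periodic Y) (+-congˡ 1 p+t≈i) t ⟩
      count (Y at_) (suc (toℕ i)) t    ≡⟨ arcCount≡count Y _ t ⟨
      arcCount Y (suc (toℕ i)) t       ≡⟨ arc≡j ⟩
      j                                ∎
      where open ≡-Reasoning

  private
    nearby-shifts-equal : ∀ {X Y Z : Subset n} {t₁ t₂} → NoConsecutive Y → ¬ Disjoint Y Z →
      ρ^ t₁ X ≡ Y → ρ^ t₂ X ≡ Z → t₁ ≤ t₂ → t₂ ≤ suc t₁ → Y ≡ Z
    nearby-shifts-equal {X} {Y} {Z} {t₁} {t₂} noConsY Y∦Z ρᵗ¹X≡Y ρᵗ²X≡Z t₁≤t₂ t₂≤1+t₁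
      with m≤n⇒m<n∨m≡n t₂≤1+t₁
    ... | inj₁ t₂<1+t₁ = begin
      Y          ≡⟨ ρᵗ¹X≡Y ⟨
      ρ^ t₁ X    ≡⟨ cong (λ t → ρ^ t X) (≤-antisym t₁≤t₂ (s≤s⁻¹ t₂<1+t₁)) ⟩
      ρ^ t₂ X    ≡⟨ ρᵗ²X≡Z ⟩
      Z          ∎
      where open ≡-Reasoning
    ... | inj₂ refl    = contradiction (subst (Disjoint Y) ρY≡Z (noConsecutive⇒disjoint-ρ noConsY)) Y∦Z
      where
      ρY≡Z : ρ Y ≡ Z
      ρY≡Z = trans (cong ρ (sym ρᵗ¹X≡Y)) ρᵗ²X≡Z

  rightNeighbour-unique : ∀ {j} {X Y Z : Subset n} → WellSpread X → NoConsecutive Y → NoConsecutive Z →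
    ¬ Disjoint Y Z → RightNeighbour j X Y → RightNeighbour j X Z → Y ≡ Z
  rightNeighbour-unique {X = X} {Y} {Z} wsX noConsY noConsZ Y∦Z Y-nb Z-nb
    with t₁ , t₁≤n∸1 , ρᵗ¹X≡Y , return₁ ← rightNeighbour⇒return Y-nb
       | t₂ , t₂≤n∸1 , ρᵗ²X≡Z , return₂ ← rightNeighbour⇒return Z-nb
    with ≤-total t₁ t₂
  ... | inj₁ t₁≤t₂ = nearby-shifts-equal noConsY Y∦Z ρᵗ¹X≡Y ρᵗ²X≡Z t₁≤t₂
                       (≮⇒≥ (no-long-return-gap {n} (wellSpread⇒balanced wsX) return₁ return₂ t₂≤n∸1))
  ... | inj₂ t₂≤t₁ = sym (nearby-shifts-equal noConsZ Z∦Y ρᵗ²X≡Z ρᵗ¹X≡Y t₂≤t₁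
                       (≮⇒≥ (no-long-return-gap {n} (wellSpread⇒balanced wsX) return₂ return₁ t₁≤n∸1)))
    where
    Z∦Y : ¬ Disjoint Z Y
    Z∦Y = Y∦Z ∘ subst Empty (∩-comm Z Y)

Unique⇒lookup-injective : ∀ {A : Set} {xs : List A} → Unique xs →
                          ∀ i j → List.lookup xs i ≡ List.lookup xs j → i ≡ j
Unique⇒lookup-injective {xs = _ ∷ _} _            Fin.zero    Fin.zero    _  = refl
Unique⇒lookup-injective {xs = _ ∷ _} (x∉xs ∷ _)   Fin.zero    (Fin.suc j) eq = contradiction eq (All.lookup x∉xs (∈-lookup j))
Unique⇒lookup-injective {xs = _ ∷ _} (x∉xs ∷ _)   (Fin.suc i) Fin.zero    eq = contradiction (sym eq) (All.lookup x∉xs (∈-lookup i))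
Unique⇒lookup-injective {xs = _ ∷ _} (_ ∷ unique) (Fin.suc i) (Fin.suc j) eq = cong Fin.suc (Unique⇒lookup-injective unique i j eq)

Unique⇒length≤ : ∀ {A : Set} {xs : List A} {k} → Unique xs → (h : ∀ {x} → x ∈ xs → ℕ) →
  (∀ {x} (x∈xs : x ∈ xs) → h x∈xs < k) →
  (∀ {x y} (x∈xs : x ∈ xs) (y∈xs : y ∈ xs) → h x∈xs ≡ h y∈xs → x ≡ y) → length xs ≤ k
Unique⇒length≤ {xs = xs} unique h h<k h-injective = injective⇒≤ {f = g} g-injective
  where
  g : Fin (length xs) → Fin _
  g i = fromℕ< (h<k (∈-lookup i))
  g-injective : ∀ {i j} → g i ≡ g j → i ≡ j
  g-injective {i} {j} gi≡gj = Unique⇒lookup-injective unique i j (h-injective (∈-lookup i) (∈-lookup j) (begin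
    h (∈-lookup i)             ≡⟨ toℕ-fromℕ< (h<k (∈-lookup i)) ⟨
    toℕ (g i)                  ≡⟨ cong toℕ gi≡gj ⟩
    toℕ (g j)                  ≡⟨ toℕ-fromℕ< (h<k (∈-lookup j)) ⟩
    h (∈-lookup j)             ∎))
    where open ≡-Reasoning

module IndependentSets (n k : ℕ) .{{_ : NonZero n}} (1≤k : 1 ≤ k) (k≤n∸k : k ≤ n ∸ k) where
  open Modular n
  open SubsetSequence n

  k≤n : k ≤ n
  k≤n = ≤-trans k≤n∸k (m∸n≤m n k)

  n∸k<n : n ∸ k < n
  n∸k<n = ∸-monoʳ-< 1≤k k≤n

  module _ {U : Subset n} (U-vertex : IsQVertex n k U) where
    private
      mechanical : ∃[ c ] (c < n × ∀ s → s < n → U at s ≡ mechanicalWord n k c s)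
      mechanical = Mechanical.balanced⇒mechanical n k (at-periodic U)
        (trans (sym (∣∣≡count U)) (proj₁ U-vertex)) (wellSpread⇒balanced (proj₂ (proj₂ U-vertex)))

    intercept : ℕ
    intercept = proj₁ mechanical

    intercept<n : intercept < n
    intercept<n = proj₁ (proj₂ mechanical)

    at≡mechanicalWord : ∀ s → s < n → U at s ≡ mechanicalWord n k intercept s
    at≡mechanicalWord = proj₂ (proj₂ mechanical)

  intercept-injective : ∀ {U V} (U-vertex : IsQVertex n k U) (V-vertex : IsQVertex n k V) →
    intercept U-vertex ≡ intercept V-vertex → U ≡ V
  intercept-injective {U} {V} U-vertex V-vertex eq = ≗⇒≡ λ s s<n → begin
    U at s                                        ≡⟨ at≡mechanicalWord U-vertex s s<n ⟩
    mechanicalWord n k (intercept U-vertex) s     ≡⟨ cong (λ c → mechanicalWord n k c s) eq ⟩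
    mechanicalWord n k (intercept V-vertex) s     ≡⟨ at≡mechanicalWord V-vertex s s<n ⟨
    V at s                                        ∎
    where open ≡-Reasoning

  -- Close (offset c₁ c₂) says that c₂ − c₁ lies in (−k, k) modulo n.
  Close : ℕ → Set
  Close d = d < k ⊎ n ∸ k < d

  close? : ∀ d → Dec (Close d)
  close? d = d <? k ⊎-dec n ∸ k <? d

  intersecting⇒close : ∀ {U V} (U-vertex : IsQVertex n k U) (V-vertex : IsQVertex n k V) →
    ¬ Disjoint U V → Close (offset (intercept U-vertex) (intercept V-vertex))
  intersecting⇒close {U} {V} U-vertex V-vertex U∦V with close? (offset (intercept U-vertex) (intercept V-vertex))
  ... | yes close = close
  ... | no  far   = contradiction disjoint U∦V
    where
    cᵤ = intercept U-vertex
    cᵥ = intercept V-vertex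
    d = offset cᵤ cᵥ
    disjoint : Disjoint U V
    disjoint (e , e∈U∩V) = far (residues-close k≤n x<k y<k (offset<n cᵤ cᵥ) x+d≈y)
      where
      s = toℕ e
      e∈U = proj₁ (x∈p∩q⁻ U V e∈U∩V)
      e∈V = proj₂ (x∈p∩q⁻ U V e∈U∩V)
      x = (cᵤ + s * (n ∸ k)) % n
      y = (cᵥ + s * (n ∸ k)) % n
      x<k : x < k
      x<k = <ᵇ≡true⇒< (trans (sym (at≡mechanicalWord U-vertex s (toℕ<n e))) (∈⇒at e∈U))
      y<k : y < k
      y<k = <ᵇ≡true⇒< (trans (sym (at≡mechanicalWord V-vertex s (toℕ<n e))) (∈⇒at e∈V))
      x+d≈y : x + d ≈ y
      x+d≈y = begin
        x + d                          ≈⟨ +-congʳ d (%≈ _) ⟩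
        cᵤ + s * (n ∸ k) + d           ≡⟨ xy∙z≈xz∙y cᵤ (s * (n ∸ k)) d ⟩
        cᵤ + d + s * (n ∸ k)           ≈⟨ +-congʳ (s * (n ∸ k)) (+-offset cᵥ (<⇒≤ (intercept<n U-vertex))) ⟩
        cᵥ + s * (n ∸ k)               ≈⟨ %≈ _ ⟨
        y                              ∎
        where open ≈-Reasoning

  -- Folds (−k, k) modulo n onto [0, k): the offset −e becomes k − e.
  fold : ℕ → ℕ
  fold d with d <? k
  ... | yes _ = d
  ... | no  _ = d ∸ (n ∸ k)

  fold<k : ∀ {d} → d < n → fold d < k
  fold<k {d} d<n with d <? k
  ... | yes d<k = d<k
  ... | no  _   = m<n+o⇒m∸n<o d (n ∸ k) {{>-nonZero 1≤k}} (subst (d <_) (sym (m∸n+n≡m k≤n)) d<n)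

  far⇒close-beyond : ∀ {d} → Close d → ¬ d < k → n ∸ k < d
  far⇒close-beyond (inj₁ d<k)    d≮k = contradiction d<k d≮k
  far⇒close-beyond (inj₂ n∸k<d) _   = n∸k<d

  -- An offset of exactly n − k lies in neither half of Close, because k ≤ n − k.
  gap-not-close : ∀ {c₀ c₁ c₂} → c₀ ≤ n → c₁ ≤ n →
                  offset c₀ c₂ ≡ offset c₀ c₁ + (n ∸ k) → ¬ Close (offset c₁ c₂)
  gap-not-close {c₀} {c₁} {c₂} c₀≤n c₁≤n d₂≡d₁+[n∸k] =
    [ (λ e<k → <⇒≱ (subst (_< k) e≡n∸k e<k) k≤n∸k) , (λ n∸k<e → <-irrefl (sym e≡n∸k) n∸k<e) ]
    where
    e≡n∸k : offset c₁ c₂ ≡ n ∸ k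
    e≡n∸k = ≈⇒≡ (offset<n c₁ c₂) n∸k<n (+-cancelˡ (offset c₀ c₁)
              (≈-trans (offset-trans c₂ c₀≤n c₁≤n) (≡⇒≈ d₂≡d₁+[n∸k])))

  far-unfold : ∀ {d d′} → Close d′ → ¬ d′ < k → d ≡ d′ ∸ (n ∸ k) → d′ ≡ d + (n ∸ k)
  far-unfold close d′≮k d≡d′∸[n∸k] =
    trans (sym (m∸n+n≡m (<⇒≤ (far⇒close-beyond close d′≮k)))) (cong (_+ (n ∸ k)) (sym d≡d′∸[n∸k]))

  fold-injective : ∀ {c₀ c₁ c₂} → c₀ ≤ n → c₁ < n → c₂ < n →
    Close (offset c₀ c₁) → Close (offset c₀ c₂) → Close (offset c₁ c₂) → Close (offset c₂ c₁) →
    fold (offset c₀ c₁) ≡ fold (offset c₀ c₂) → c₁ ≡ c₂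
  fold-injective {c₀} {c₁} {c₂} c₀≤n c₁<n c₂<n close₁ close₂ close₁₂ close₂₁ eq
    with offset c₀ c₁ <? k | offset c₀ c₂ <? k
  ... | yes _   | yes _   = offset-injective c₀≤n c₁<n c₂<n eq
  ... | no d₁≮k | no d₂≮k = offset-injective c₀≤n c₁<n c₂<n
    (∸-cancelʳ-≡ (<⇒≤ (far⇒close-beyond close₁ d₁≮k)) (<⇒≤ (far⇒close-beyond close₂ d₂≮k)) eq)
  ... | yes _   | no d₂≮k =
    contradiction close₁₂ (gap-not-close c₀≤n (<⇒≤ c₁<n) (far-unfold close₂ d₂≮k eq))
  ... | no d₁≮k | yes _   =
    contradiction close₂₁ (gap-not-close c₀≤n (<⇒≤ c₂<n) (far-unfold close₁ d₁≮k (sym eq)))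

  independent⇒length≤k : ∀ {A X} → IndependentQ n k A → X ∈ A → length A ≤ k
  independent⇒length≤k {A} {X} (unique , vertices , intersecting) X∈A =
    Unique⇒length≤ unique label (λ Y∈A → fold<k (offset<n (c X∈A) (c Y∈A))) label-injective
    where
    vertex : ∀ {Y} → Y ∈ A → IsQVertex n k Y
    vertex = All.lookup vertices
    c : ∀ {Y} → Y ∈ A → ℕ
    c = intercept ∘ vertex
    label : ∀ {Y} → Y ∈ A → ℕ
    label Y∈A = fold (offset (c X∈A) (c Y∈A))
    close : ∀ {Y Z} (Y∈A : Y ∈ A) (Z∈A : Z ∈ A) → Close (offset (c Y∈A) (c Z∈A))
    close Y∈A Z∈A = intersecting⇒close (vertex Y∈A) (vertex Z∈A) (intersecting Y∈A Z∈A)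
    label-injective : ∀ {Y Z} (Y∈A : Y ∈ A) (Z∈A : Z ∈ A) → label Y∈A ≡ label Z∈A → Y ≡ Z
    label-injective Y∈A Z∈A = intercept-injective (vertex Y∈A) (vertex Z∈A) ∘
      fold-injective (<⇒≤ (intercept<n (vertex X∈A))) (intercept<n (vertex Y∈A)) (intercept<n (vertex Z∈A))
        (close X∈A Y∈A) (close X∈A Z∈A) (close Y∈A Z∈A) (close Z∈A Y∈A)

corollary15 : (n k : ℕ) → .{{_ : NonZero n}} → 1 ≤ k → 2 * k ≤ n → gcd n k ≡ 1 →
    (A : List (Subset n)) → IndependentQ n k A → (X : Subset n) → X ∈ A →
    ((j : ℕ) → 1 ≤ j → j ≤ k ∸ 1 → ∀ {Y Z} → Y ∈ A → Z ∈ A →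
       RightNeighbour j X Y → RightNeighbour j X Z → Y ≡ Z)
    × length A ≤ k
corollary15 n k 1≤k 2k≤n _ A independent@(_ , vertices , intersecting) X X∈A =
  (λ _ _ _ Y∈A Z∈A →
     rightNeighbour-unique (wellSpread X∈A) (noConsecutive Y∈A) (noConsecutive Z∈A) (intersecting Y∈A Z∈A)) ,
  independent⇒length≤k independent X∈A
  where
  open RightNeighbours n
  open IndependentSets n k 1≤k (m+n≤o⇒m≤o∸n k (subst (_≤ n) (cong (k +_) (+-identityʳ k)) 2k≤n))
  wellSpread : ∀ {Y} → Y ∈ A → WellSpread Y
  wellSpread = proj₂ ∘ proj₂ ∘ All.lookup vertices
  noConsecutive : ∀ {Y} → Y ∈ A → NoConsecutive Y
  noConsecutive = proj₁ ∘ proj₂ ∘ All.lookup vertices
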